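{- For all non-negative integers $n_0,n_1,n_2$, $$\tilde{\alpha}(0^{n_0},1^{n_1},2^{n_2})\geq \frac{3}{4}n_0+\frac{1}{2}(n_1+n_2)-\frac{7}{4}.$$
   Context: All graphs are finite, simple and undirected. For a bipartite graph $G$ with (fixed) partite sets $A$ and $B$, a bihole of order $k$ is an independent set $I$ of $G$ with $|I\cap A|=|I\cap B|=k$. For non-negative integers $d_1<d_2<\dots<d_\ell$ and non-negative integers $n_1,\dots,n_\ell$, $\tilde{\alpha}(d_1^{n_1},\dots,d_\ell^{n_\ell})$ denotes the largest integer $k$ such that every bipartite graph $G$ with partite sets $A$ and $B$ satisfying $|A|=|B|=n_1+\dots+n_\ell$ and $|\{u\in A: d_G(u)=d_i\}|=n_i$ for every $i\in\{1,\dots,\ell\}$ has a bihole of order $k$. Here $\tilde{\alpha}(0^{n_0},1^{n_1},2^{n_2})$ is this quantity with degrees $0,1,2$ and multiplicities $n_0,n_1,n_2$. -}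

module Defs where

open import Data.Bool using (Bool; true; false)
open import Data.Nat using (ℕ; _+_; _≟_)
open import Data.Fin using (Fin)
open import Data.Fin.Subset using (Subset; _∈_; ∣_∣)
open import Data.Vec using (tabulate)
open import Data.Product using (Σ; _×_)
open import Relation.Nullary using (does)
open import Relation.Binary.PropositionalEquality using (_≡_)

-- A bipartite graph with partite sets A = Fin m and B = Fin m:
-- adj u v = true iff u ∈ A is adjacent to v ∈ B.
-- (Simple and bipartite: edges only go between A and B, at most one per pair.)
BipGraph : ℕ → Set
BipGraph m = Fin m → Fin m → Bool

degA : ∀ {m} → BipGraph m → Fin m → ℕ
degA G u = ∣ tabulate (G u) ∣

countDegA : ∀ {m} → BipGraph m → ℕ → ℕ
countDegA G d = ∣ tabulate (λ u → does (degA G u ≟ d)) ∣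

-- a bihole of order k: an independent set I with |I ∩ A| = |I ∩ B| = k,
-- given by S = I ∩ A and T = I ∩ B (no edges inside A or inside B exist)
HasBihole : ∀ {m} → BipGraph m → ℕ → Set
HasBihole {m} G k =
  Σ (Subset m) λ S → Σ (Subset m) λ T →
    (∣ S ∣ ≡ k) × (∣ T ∣ ≡ k) ×
    (∀ u v → u ∈ S → v ∈ T → G u v ≡ false)

Class012 : (n0 n1 n2 : ℕ) → BipGraph (n0 + n1 + n2) → Set
Class012 n0 n1 n2 G =
  (countDegA G 0 ≡ n0) × (countDegA G 1 ≡ n1) × (countDegA G 2 ≡ n2)

-- k is admissible for α̃(0^n0,1^n1,2^n2): every graph in the class has a bihole of order k.
-- α̃ is the largest admissible k, so "α̃ ≥ x" holds iff some admissible k satisfies k ≥ x.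
Admissible012 : (n0 n1 n2 k : ℕ) → Set
Admissible012 n0 n1 n2 k =
  (G : BipGraph (n0 + n1 + n2)) → Class012 n0 n1 n2 G → HasBihole G k

-- Vertices of A of degree 1 or 2 are the edges (resp. loops) of a multigraph on B with
-- M = n₁ + n₂ edges. For W ⊆ B, the vertices of A with all their neighbours in W are
-- independent from B ∖ W; they are the n₀ isolated vertices plus the e W edges spanned by W.
-- So it suffices to find W with |W| = n − k and n₀ + e W ≥ k.
--
-- Key lemma: every V ⊆ B has, for each w ≤ |V|, a w-subset W with
-- w · min(|V|, e V) ≤ |V| · (e W + 1). Grow X ⊆ V greedily from one vertex, adding a vertex
-- only when this increases e; then X has subsets of every size p spanning at least p − 1
-- edges. An edge of V from X to V ∖ X would let X grow further, because edges have at most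
-- two ends, so e V ≤ e X + e (V ∖ X). Taking W inside the denser of X and V ∖ X (by
-- induction for V ∖ X) and topping it up with the other part gives the bound. For V = B
-- and w = n − k it yields n₀ + e W ≥ k as soon as 4k + 4 ≤ 3n₀ + 2M.

module Submission where

open import Defs
open import Data.Bool using (Bool; true)
open import Data.Bool.Properties using (¬-not)
open import Data.Nat hiding (∣_-_∣)
open import Data.Nat.Properties
open import Data.Nat.DivMod using (m≡m%n+[m/n]*n; m%n<n; m/n*n≤m)
open import Data.Nat.Tactic.RingSolver using (solve-∀)
open import Data.Fin as Fin using (Fin)
open import Data.Fin.Properties using (any?)
open import Data.Fin.Subset
open import Data.Fin.Subset.Properties
open import Data.Fin.Subset.Induction using (Acc; acc; ⊂-wellFounded; ⊃-wellFounded)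
open import Data.Product using (Σ; ∃; _×_; _,_; proj₂)
open import Data.Sum using (inj₁; inj₂)
open import Data.Vec using (_∷_; []; here; there; tabulate)
open import Data.Vec.Properties using (lookup∘tabulate; []=⇒lookup; lookup⇒[]=)
open import Function using (_∘_)
open import Level using (Level)
open import Relation.Binary.PropositionalEquality
open import Relation.Nullary using (¬_; yes; no; does; contradiction; ¬?; _×-dec_)
open import Relation.Nullary.Decidable using (dec-true; decidable-stable)
open import Relation.Unary using (Pred; Decidable)

private variable
  ℓ : Level
  n : ℕ

Disjoint : Subset n → Subset n → Set
Disjoint p q = ∀ {x} → x ∈ p → x ∉ q

drop-∷-Disjoint : ∀ {s t} {p q : Subset n} → Disjoint (s ∷ p) (t ∷ q) → Disjoint p q
drop-∷-Disjoint d x∈p x∈q = d (there x∈p) (there x∈q)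

∣p∪q∣≤∣p∣+∣q∣ : (p q : Subset n) → ∣ p ∪ q ∣ ≤ ∣ p ∣ + ∣ q ∣
∣p∪q∣≤∣p∣+∣q∣ []            []            = z≤n
∣p∪q∣≤∣p∣+∣q∣ (outside ∷ p) (outside ∷ q) = ∣p∪q∣≤∣p∣+∣q∣ p q
∣p∪q∣≤∣p∣+∣q∣ (outside ∷ p) (inside  ∷ q) =
  ≤-trans (s≤s (∣p∪q∣≤∣p∣+∣q∣ p q)) (≤-reflexive (sym (+-suc ∣ p ∣ ∣ q ∣)))
∣p∪q∣≤∣p∣+∣q∣ (inside  ∷ p) (outside ∷ q) = s≤s (∣p∪q∣≤∣p∣+∣q∣ p q)
∣p∪q∣≤∣p∣+∣q∣ (inside  ∷ p) (inside  ∷ q) =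
  s≤s (≤-trans (∣p∪q∣≤∣p∣+∣q∣ p q) (+-monoʳ-≤ ∣ p ∣ (n≤1+n ∣ q ∣)))

Disjoint⇒∣p∪q∣≡∣p∣+∣q∣ : (p q : Subset n) → Disjoint p q → ∣ p ∪ q ∣ ≡ ∣ p ∣ + ∣ q ∣
Disjoint⇒∣p∪q∣≡∣p∣+∣q∣ []            []            _ = refl
Disjoint⇒∣p∪q∣≡∣p∣+∣q∣ (outside ∷ p) (outside ∷ q) d =
  Disjoint⇒∣p∪q∣≡∣p∣+∣q∣ p q (drop-∷-Disjoint d)
Disjoint⇒∣p∪q∣≡∣p∣+∣q∣ (outside ∷ p) (inside  ∷ q) d =
  trans (cong suc (Disjoint⇒∣p∪q∣≡∣p∣+∣q∣ p q (drop-∷-Disjoint d))) (sym (+-suc ∣ p ∣ ∣ q ∣))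
Disjoint⇒∣p∪q∣≡∣p∣+∣q∣ (inside  ∷ p) (outside ∷ q) d =
  cong suc (Disjoint⇒∣p∪q∣≡∣p∣+∣q∣ p q (drop-∷-Disjoint d))
Disjoint⇒∣p∪q∣≡∣p∣+∣q∣ (inside  ∷ p) (inside  ∷ q) d = contradiction here (d here)

p⊆q⇒∣q∣≡∣p∣+∣q─p∣ : {p q : Subset n} → p ⊆ q → ∣ q ∣ ≡ ∣ p ∣ + ∣ q ─ p ∣
p⊆q⇒∣q∣≡∣p∣+∣q─p∣ {p = []}          {[]}          _   = refl
p⊆q⇒∣q∣≡∣p∣+∣q─p∣ {p = outside ∷ p} {outside ∷ q} p⊆q = p⊆q⇒∣q∣≡∣p∣+∣q─p∣ (drop-∷-⊆ p⊆q)
p⊆q⇒∣q∣≡∣p∣+∣q─p∣ {p = outside ∷ p} {inside  ∷ q} p⊆q =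
  trans (cong suc (p⊆q⇒∣q∣≡∣p∣+∣q─p∣ (drop-∷-⊆ p⊆q))) (sym (+-suc ∣ p ∣ ∣ q ─ p ∣))
p⊆q⇒∣q∣≡∣p∣+∣q─p∣ {p = inside  ∷ p} {outside ∷ q} p⊆q = contradiction (p⊆q here) λ ()
p⊆q⇒∣q∣≡∣p∣+∣q─p∣ {p = inside  ∷ p} {inside  ∷ q} p⊆q = cong suc (p⊆q⇒∣q∣≡∣p∣+∣q─p∣ (drop-∷-⊆ p⊆q))

∃⊆-ofSize : ∀ {n k} (p : Subset n) → k ≤ ∣ p ∣ → ∃ λ q → q ⊆ p × ∣ q ∣ ≡ k
∃⊆-ofSize {n} {zero}  p             _   = ⊥ , ⊥⊆ , ∣⊥∣≡0 n
∃⊆-ofSize {k = suc k} (inside  ∷ p) k<∣p∣ with ∃⊆-ofSize p (s≤s⁻¹ k<∣p∣)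
... | q , q⊆p , ∣q∣≡k = inside ∷ q , s⊆s q⊆p , cong suc ∣q∣≡k
∃⊆-ofSize {k = suc k} (outside ∷ p) k<∣p∣ with ∃⊆-ofSize p k<∣p∣
... | q , q⊆p , ∣q∣≡k = outside ∷ q , out⊆ q⊆p , ∣q∣≡k

x∈p⇒⁅x⁆⊆p : ∀ {x} {p : Subset n} → x ∈ p → ⁅ x ⁆ ⊆ p
x∈p⇒⁅x⁆⊆p {x = x} x∈p y∈⁅x⁆ = subst (_∈ _) (sym (x∈⁅y⁆⇒x≡y x y∈⁅x⁆)) x∈p

x∈p⇒1≤∣p∣ : ∀ {x} {p : Subset n} → x ∈ p → 1 ≤ ∣ p ∣
x∈p⇒1≤∣p∣ {x = x} x∈p = subst (_≤ _) (∣⁅x⁆∣≡1 x) (p⊆q⇒∣p∣≤∣q∣ (x∈p⇒⁅x⁆⊆p x∈p))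

∣p∣≤2⇒⊆∪⁅y⁆ : ∀ {x y} {p q : Subset n} → ∣ p ∣ ≤ 2 → x ∈ p → x ∈ q → y ∈ p → y ∉ q →
              p ⊆ q ∪ ⁅ y ⁆
∣p∣≤2⇒⊆∪⁅y⁆ {x = x} {y} {p} {q} ∣p∣≤2 x∈p x∈q y∈p y∉q {z} z∈p with z ∈? q | z Fin.≟ y
... | yes z∈q | _        = x∈p∪q⁺ (inj₁ z∈q)
... | no _    | yes refl = x∈p∪q⁺ (inj₂ (x∈⁅x⁆ y))
... | no z∉q  | no z≢y   = contradiction ∣p∣≤2 (<⇒≱ (begin-strict
  2                 ≤⟨ s≤s (x∈p⇒1≤∣p∣ z∈p-x-y) ⟩
  suc ∣ p - x - y ∣ ≤⟨ x∈p⇒∣p-x∣<∣p∣ (x∈p∧x≢y⇒x∈p-y y∈p λ { refl → y∉q x∈q }) ⟩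
  ∣ p - x ∣         <⟨ x∈p⇒∣p-x∣<∣p∣ x∈p ⟩
  ∣ p ∣             ∎))
  where
  open ≤-Reasoning
  z∈p-x-y = x∈p∧x≢y⇒x∈p-y (x∈p∧x≢y⇒x∈p-y z∈p λ { refl → z∉q x∈q }) z≢y

x∈p─q⇒x∉q : ∀ {x} (p q : Subset n) → x ∈ p ─ q → x ∉ q
x∈p─q⇒x∉q (s ∷ p) (t      ∷ q) (there x∈p─q) (there x∈q) = x∈p─q⇒x∉q p q x∈p─q x∈q
x∈p─q⇒x∉q (s ∷ p) (inside ∷ q) ()            here

∪-⊆ : {p q r : Subset n} → p ⊆ r → q ⊆ r → p ∪ q ⊆ r
∪-⊆ {p = p} {q} p⊆r q⊆r x∈p∪q with x∈p∪q⁻ p q x∈p∪q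
... | inj₁ x∈p = p⊆r x∈p
... | inj₂ x∈q = q⊆r x∈q

x∉p⇒∣p∪⁅x⁆∣≡1+∣p∣ : ∀ {x} (p : Subset n) → x ∉ p → ∣ p ∪ ⁅ x ⁆ ∣ ≡ suc ∣ p ∣
x∉p⇒∣p∪⁅x⁆∣≡1+∣p∣ {x = x} p x∉p = begin
  ∣ p ∪ ⁅ x ⁆ ∣     ≡⟨ Disjoint⇒∣p∪q∣≡∣p∣+∣q∣ p ⁅ x ⁆ (λ y∈p y∈⁅x⁆ → x∉p (subst (_∈ p) (x∈⁅y⁆⇒x≡y x y∈⁅x⁆) y∈p)) ⟩
  ∣ p ∣ + ∣ ⁅ x ⁆ ∣ ≡⟨ cong (∣ p ∣ +_) (∣⁅x⁆∣≡1 x) ⟩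
  ∣ p ∣ + 1         ≡⟨ +-comm ∣ p ∣ 1 ⟩
  suc ∣ p ∣         ∎
  where open ≡-Reasoning

1≤∣p∣⇒Nonempty : {p : Subset n} → 1 ≤ ∣ p ∣ → Nonempty p
1≤∣p∣⇒Nonempty {n} {p} 1≤∣p∣ with nonempty? p
... | yes ne = ne
... | no ¬ne = contradiction (trans (cong ∣_∣ (Empty-unique ¬ne)) (∣⊥∣≡0 n)) (≢-nonZero⁻¹ _ ⦃ >-nonZero 1≤∣p∣ ⦄)

Disjoint-∪ : {p q r : Subset n} → Disjoint p q → Disjoint p r → Disjoint p (q ∪ r)
Disjoint-∪ {q = q} {r} p∩q=∅ p∩r=∅ x∈p x∈q∪r with x∈p∪q⁻ q r x∈q∪r
... | inj₁ x∈q = p∩q=∅ x∈p x∈q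
... | inj₂ x∈r = p∩r=∅ x∈p x∈r

∈-tabulate⁺ : ∀ {f : Fin n → Bool} {x} → f x ≡ true → x ∈ tabulate f
∈-tabulate⁺ {f = f} {x} fx = lookup⇒[]= x _ (trans (lookup∘tabulate f x) fx)

∈-tabulate⁻ : ∀ {f : Fin n → Bool} {x} → x ∈ tabulate f → f x ≡ true
∈-tabulate⁻ {f = f} {x} x∈ = trans (sym (lookup∘tabulate f x)) ([]=⇒lookup x∈)

⟦_⟧ : {P : Pred (Fin n) ℓ} → Decidable P → Subset n
⟦ P? ⟧ = tabulate (does ∘ P?)

module _ {P : Pred (Fin n) ℓ} {P? : Decidable P} where

  ∈⟦⟧⁺ : ∀ {x} → P x → x ∈ ⟦ P? ⟧
  ∈⟦⟧⁺ {x} px = ∈-tabulate⁺ (dec-true (P? x) px)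

  ∈⟦⟧⁻ : ∀ {x} → x ∈ ⟦ P? ⟧ → P x
  ∈⟦⟧⁻ {x} x∈ with P? x | ∈-tabulate⁻ {f = does ∘ P?} x∈
  ... | yes px | _  = px
  ... | no _   | ()

⊈⇒∃∉ : {p q : Subset n} → ¬ p ⊆ q → ∃ λ x → x ∈ p × x ∉ q
⊈⇒∃∉ {p = p} {q} p⊈q with any? (λ x → x ∈? p ×-dec ¬? (x ∈? q))
... | yes witness = witness
... | no ¬witness =
  contradiction (λ {x} x∈p → decidable-stable (x ∈? q) λ x∉q → ¬witness (x , x∈p , x∉q)) p⊈q

-- Densities are compared by cross-multiplication: a set of N = x + r vertices splits into
-- parts of sizes x and r spanning eX and mR edges, and c = N ⊓ m caps its m edges at N.
⊓-split-bound : ∀ {N x r eX m mR} → N ≡ x + r → x ≤ eX + 1 → m ≤ eX + mR →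
                x * (N ⊓ m) ≤ eX * N → N ⊓ m ≤ eX + r ⊓ mR
⊓-split-bound {N} {x} {r} {eX} {m} {mR} refl x≤eX+1 m≤ xc≤eXN with ≤-total mR r
... | inj₁ mR≤r = begin
  N ⊓ m         ≤⟨ m⊓n≤n N m ⟩
  m             ≤⟨ m≤ ⟩
  eX + mR       ≡⟨ cong (eX +_) (sym (m≥n⇒m⊓n≡n mR≤r)) ⟩
  eX + r ⊓ mR   ∎
  where open ≤-Reasoning
... | inj₂ r≤mR = subst (λ t → N ⊓ m ≤ eX + t) (sym (m≤n⇒m⊓n≡m r≤mR)) (≮⇒≥ λ eX+r<c →
  let instance _ = >-nonZero (≤-trans (s≤s z≤n) eX+r<c)
      N≤c = ≤-trans (+-monoˡ-≤ r (≤-trans x≤eX+1 (≤-reflexive (+-comm eX 1)))) eX+r<c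
      x≤eX = *-cancelʳ-≤ x eX (N ⊓ m) (≤-trans xc≤eXN (*-monoʳ-≤ eX N≤c))
  in <-irrefl refl (≤-trans eX+r<c (≤-trans (m⊓n≤m N m) (+-monoˡ-≤ r x≤eX))))

sparse-part⇒dense-complement : ∀ {N x r eX m mR} → N ≡ x + r → m ≤ eX + mR →
                               eX * N < x * (N ⊓ m) → (N ⊓ m) * r ≤ (r ⊓ mR) * N
sparse-part⇒dense-complement {N} {x} {r} {eX} {m} {mR} refl m≤ eXN<xc with ≤-total mR r
... | inj₂ r≤mR = begin
  (N ⊓ m) * r   ≤⟨ *-monoˡ-≤ r (m⊓n≤m N m) ⟩
  N * r         ≡⟨ *-comm N r ⟩
  r * N         ≡⟨ cong (_* N) (sym (m≤n⇒m⊓n≡m r≤mR)) ⟩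
  (r ⊓ mR) * N  ∎
  where open ≤-Reasoning
... | inj₁ mR≤r = subst (λ t → c * r ≤ t * N) (sym (m≥n⇒m⊓n≡n mR≤r))
  (<⇒≤ (+-cancelˡ-< (x * c) (c * r) (mR * N) (begin-strict
    x * c + c * r        ≡⟨ cong (_+ c * r) (*-comm x c) ⟩
    c * x + c * r        ≡⟨ *-distribˡ-+ c x r ⟨
    c * N                ≤⟨ *-monoˡ-≤ N (≤-trans (m⊓n≤n N m) m≤) ⟩
    (eX + mR) * N        ≡⟨ *-distribʳ-+ N eX mR ⟩
    eX * N + mR * N      <⟨ +-monoˡ-< (mR * N) eXN<xc ⟩
    x * c + mR * N       ∎)))
  where
  open ≤-Reasoning
  c = N ⊓ m

density-transfer : ∀ {w c cR N r e} → 0 < r →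
                   w * cR ≤ r * (e + 1) → c * r ≤ cR * N → w * c ≤ N * (e + 1)
density-transfer {w} {c} {cR} {N} {r} {e} 0<r wcR≤ cr≤ = *-cancelˡ-≤ r {{>-nonZero 0<r}} (begin
  r * (w * c)     ≡⟨ solve₁ r w c ⟩
  w * (c * r)     ≤⟨ *-monoʳ-≤ w cr≤ ⟩
  w * (cR * N)    ≡⟨ *-assoc w cR N ⟨
  w * cR * N      ≤⟨ *-monoˡ-≤ N wcR≤ ⟩
  r * (e + 1) * N ≡⟨ solve₂ r e N ⟩
  r * (N * (e + 1)) ∎)
  where
  open ≤-Reasoning
  solve₁ : ∀ r w c → r * (w * c) ≡ w * (c * r)
  solve₁ = solve-∀
  solve₂ : ∀ r e N → r * (e + 1) * N ≡ r * (N * (e + 1))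
  solve₂ = solve-∀

dense-part-extension-bound : ∀ {N x u r c cR eX e} → N ≡ x + r → 0 < u → u ≤ r →
  u * cR ≤ r * (e + 1) → x * c ≤ eX * N → c ≤ eX + cR →
  (x + u) * c ≤ N * (eX + e + 1)
dense-part-extension-bound {x = x} {u} {c = c} {cR} {eX} {e} refl 0<u u≤r ucR≤ xc≤ c≤
  with s , refl ← m≤n⇒∃[o]m+o≡n u≤r =
  *-cancelˡ-≤ (u + s) {{>-nonZero (≤-trans 0<u (m≤m+n u s))}} (begin
    (u + s) * ((x + u) * c)           ≡⟨ solve₁ x u s c ⟩
    s * (x * c) + u * c * N           ≤⟨ +-mono-≤ (*-monoʳ-≤ s xc≤) (*-monoˡ-≤ N (*-monoʳ-≤ u c≤)) ⟩
    s * (eX * N) + u * (eX + cR) * N  ≡⟨ solve₂ x u s cR eX ⟩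
    N * ((u + s) * eX) + N * (u * cR) ≤⟨ +-monoʳ-≤ (N * ((u + s) * eX)) (*-monoʳ-≤ N ucR≤) ⟩
    N * ((u + s) * eX) + N * ((u + s) * (e + 1)) ≡⟨ solve₃ N (u + s) eX e ⟩
    (u + s) * (N * (eX + e + 1))      ∎)
  where
  open ≤-Reasoning
  N = x + (u + s)
  solve₁ : ∀ x u s c → (u + s) * ((x + u) * c) ≡ s * (x * c) + u * c * (x + (u + s))
  solve₁ = solve-∀
  solve₂ : ∀ x u s cR eX → s * (eX * (x + (u + s))) + u * (eX + cR) * (x + (u + s)) ≡
           (x + (u + s)) * ((u + s) * eX) + (x + (u + s)) * (u * cR)
  solve₂ = solve-∀
  solve₃ : ∀ N r eX e → N * (r * eX) + N * (r * (e + 1)) ≡ r * (N * (eX + e + 1))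
  solve₃ = solve-∀

dense-complement-extension-bound : ∀ {N r p c mR e} → c ≤ N → c * r ≤ mR * N → p ≤ e + 1 →
                                   (r + p) * c ≤ N * (mR + e + 1)
dense-complement-extension-bound {N} {r} {p} {c} {mR} {e} c≤N cr≤ p≤ = begin
  (r + p) * c            ≡⟨ *-distribʳ-+ c r p ⟩
  r * c + p * c          ≤⟨ +-mono-≤ (≤-reflexive (*-comm r c)) (*-mono-≤ p≤ c≤N) ⟩
  c * r + (e + 1) * N    ≤⟨ +-monoˡ-≤ ((e + 1) * N) cr≤ ⟩
  mR * N + (e + 1) * N   ≡⟨ solve₁ mR N e ⟩
  N * (mR + e + 1)       ∎
  where
  open ≤-Reasoning
  solve₁ : ∀ mR N e → mR * N + (e + 1) * N ≡ N * (mR + e + 1)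
  solve₁ = solve-∀

module _ {n} (G : BipGraph n) where

  nbhd : Fin n → Subset n
  nbhd u = tabulate (G u)

  spanned : Subset n → Subset n
  spanned W = ⟦ (λ u → nonempty? (nbhd u) ×-dec nbhd u ⊆? W) ⟧

  e : Subset n → ℕ
  e W = ∣ spanned W ∣

  private variable
    u x y : Fin n
    V W W′ X : Subset n

  ∈nbhd⁺ : G u x ≡ true → x ∈ nbhd u
  ∈nbhd⁺ = ∈-tabulate⁺

  ∈spanned⁺ : Nonempty (nbhd u) → nbhd u ⊆ W → u ∈ spanned W
  ∈spanned⁺ {W = W} ne N⊆W = ∈⟦⟧⁺ {P? = λ u → nonempty? (nbhd u) ×-dec nbhd u ⊆? W} (ne , N⊆W)

  ∈spanned⁻ : u ∈ spanned W → Nonempty (nbhd u) × nbhd u ⊆ W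
  ∈spanned⁻ {u} {W} = ∈⟦⟧⁻ {P? = λ u → nonempty? (nbhd u) ×-dec nbhd u ⊆? W}

  spanned-mono : W ⊆ W′ → spanned W ⊆ spanned W′
  spanned-mono W⊆W′ u∈ with ∈spanned⁻ u∈
  ... | ne , N⊆W = ∈spanned⁺ ne (⊆-trans N⊆W W⊆W′)

  e-mono : W ⊆ W′ → e W ≤ e W′
  e-mono = p⊆q⇒∣p∣≤∣q∣ ∘ spanned-mono

  e-superadditive : Disjoint W W′ → e W + e W′ ≤ e (W ∪ W′)
  e-superadditive {W} {W′} W∩W′=∅ = begin
    e W + e W′                      ≡⟨ Disjoint⇒∣p∪q∣≡∣p∣+∣q∣ (spanned W) (spanned W′) spanned-disjoint ⟨
    ∣ spanned W ∪ spanned W′ ∣      ≤⟨ p⊆q⇒∣p∣≤∣q∣ (∪-⊆ (spanned-mono (p⊆p∪q W′)) (spanned-mono (q⊆p∪q W W′))) ⟩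
    e (W ∪ W′)                      ∎
    where
    open ≤-Reasoning
    spanned-disjoint : Disjoint (spanned W) (spanned W′)
    spanned-disjoint u∈W u∈W′ with ∈spanned⁻ u∈W | ∈spanned⁻ u∈W′
    ... | (x , x∈N) , N⊆W | _ , N⊆W′ = W∩W′=∅ (N⊆W x∈N) (N⊆W′ x∈N)

  Dense : Subset n → Set
  Dense X = ∣ X ∣ ≤ e X + 1

  DenseAtEverySize : Subset n → Set
  DenseAtEverySize X = ∀ {p} → p ≤ ∣ X ∣ → ∃ λ Y → Y ⊆ X × ∣ Y ∣ ≡ p × Dense Y

  DenseAtEverySize⇒Dense : DenseAtEverySize X → Dense X
  DenseAtEverySize⇒Dense {X} X-dense with X-dense ≤-refl
  ... | Y , Y⊆X , ∣Y∣≡∣X∣ , Y-dense =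
    subst (_≤ e X + 1) ∣Y∣≡∣X∣ (≤-trans Y-dense (+-monoˡ-≤ 1 (e-mono Y⊆X)))

  DenseAtEverySize-⊥ : DenseAtEverySize ⊥
  DenseAtEverySize-⊥ {p} p≤∣⊥∣ with n≤0⇒n≡0 (subst (p ≤_) (∣⊥∣≡0 n) p≤∣⊥∣)
  ... | refl = ⊥ , ⊆-refl , ∣⊥∣≡0 n , subst (_≤ e ⊥ + 1) (sym (∣⊥∣≡0 n)) z≤n

  DenseAtEverySize-∪⁅⁆ : y ∉ X → DenseAtEverySize X → Dense (X ∪ ⁅ y ⁆) →
                          DenseAtEverySize (X ∪ ⁅ y ⁆)
  DenseAtEverySize-∪⁅⁆ {y} {X} y∉X X-dense X∪y-dense {p} p≤ with p ≤? ∣ X ∣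
  ... | yes p≤∣X∣ with X-dense p≤∣X∣
  ...   | Y , Y⊆X , ∣Y∣≡p , Y-dense = Y , ⊆-trans Y⊆X (p⊆p∪q ⁅ y ⁆) , ∣Y∣≡p , Y-dense
  DenseAtEverySize-∪⁅⁆ {y} {X} y∉X X-dense X∪y-dense {p} p≤ | no p≰∣X∣ =
    X ∪ ⁅ y ⁆ , ⊆-refl ,
    ≤-antisym (subst (_≤ p) (sym (x∉p⇒∣p∪⁅x⁆∣≡1+∣p∣ X y∉X)) (≰⇒> p≰∣X∣)) p≤ ,
    X∪y-dense

  Saturated : Subset n → Subset n → Set
  Saturated V X = ∀ {y} → y ∈ V → y ∉ X → e (X ∪ ⁅ y ⁆) ≤ e X

  grow : Acc _⊃_ X → X ⊆ V → DenseAtEverySize X →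
         ∃ λ X′ → X ⊆ X′ × X′ ⊆ V × DenseAtEverySize X′ × Saturated V X′
  grow {X} {V} (acc rec) X⊆V X-dense
    with any? (λ y → y ∈? V ×-dec ¬? (y ∈? X) ×-dec e X <? e (X ∪ ⁅ y ⁆))
  ... | no ¬grows =
    X , ⊆-refl , X⊆V , X-dense , λ y∈V y∉X → ≮⇒≥ λ grows → ¬grows (_ , y∈V , y∉X , grows)
  ... | yes (y , y∈V , y∉X , grows)
    with grow (rec X⊂X∪y) (∪-⊆ X⊆V (x∈p⇒⁅x⁆⊆p y∈V)) (DenseAtEverySize-∪⁅⁆ y∉X X-dense X∪y-dense)
    where
    X⊂X∪y : X ⊂ X ∪ ⁅ y ⁆
    X⊂X∪y = p⊆p∪q ⁅ y ⁆ , y , x∈p∪q⁺ (inj₂ (x∈⁅x⁆ y)) , y∉X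
    X∪y-dense : Dense (X ∪ ⁅ y ⁆)
    X∪y-dense = subst (_≤ e (X ∪ ⁅ y ⁆) + 1) (sym (x∉p⇒∣p∪⁅x⁆∣≡1+∣p∣ X y∉X))
                  (≤-trans (s≤s (DenseAtEverySize⇒Dense X-dense)) (+-monoˡ-≤ 1 grows))
  ... | X′ , X∪y⊆X′ , rest = X′ , ⊆-trans (p⊆p∪q ⁅ y ⁆) X∪y⊆X′ , rest

  grow-from : ∀ {v V} → v ∈ V → ∃ λ X → v ∈ X × X ⊆ V × DenseAtEverySize X × Saturated V X
  grow-from {v} {V} v∈V
    with grow (⊃-wellFounded X₀) (∪-⊆ ⊥⊆ (x∈p⇒⁅x⁆⊆p v∈V)) (DenseAtEverySize-∪⁅⁆ ∉⊥ DenseAtEverySize-⊥ X₀-dense)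
    where
    X₀ = ⊥ ∪ ⁅ v ⁆
    X₀-dense : Dense X₀
    X₀-dense = subst (_≤ e X₀ + 1) (sym (trans (x∉p⇒∣p∪⁅x⁆∣≡1+∣p∣ {x = v} (⊥ {n = n}) ∉⊥) (cong suc (∣⊥∣≡0 n))))
                 (m≤n+m 1 (e X₀))
  ... | X , X₀⊆X , X-facts = X , X₀⊆X (x∈p∪q⁺ (inj₂ (x∈⁅x⁆ v))) , X-facts

  ProportionalSubset : Subset n → ℕ → Subset n → Set
  ProportionalSubset V w W = W ⊆ V × ∣ W ∣ ≡ w × w * (∣ V ∣ ⊓ e V) ≤ ∣ V ∣ * (e W + 1)

  HasProportionalSubsets : Subset n → Set
  HasProportionalSubsets V = ∀ {w} → w ≤ ∣ V ∣ → ∃ (ProportionalSubset V w)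

  module _ {V X : Subset n} (X⊆V : X ⊆ V) (X-dense : DenseAtEverySize X)
           (e-split : e V ≤ e X + e (V ─ X)) (R-proportional : HasProportionalSubsets (V ─ X)) where

    private
      R = V ─ X
      N = ∣ V ∣
      c = N ⊓ e V

      N≡∣X∣+∣R∣ : N ≡ ∣ X ∣ + ∣ R ∣
      N≡∣X∣+∣R∣ = p⊆q⇒∣q∣≡∣p∣+∣q─p∣ X⊆V

      R⊆V : R ⊆ V
      R⊆V = p─q⊆p V X

      ⊆X-⊆R-disjoint : ∀ {Y W} → Y ⊆ X → W ⊆ R → Disjoint Y W
      ⊆X-⊆R-disjoint Y⊆X W⊆R x∈Y x∈W = x∈p─q⇒x∉q V X (W⊆R x∈W) (Y⊆X x∈Y)

    ⊆X-proportional : ∀ {Y} → Y ⊆ X → Dense Y → ProportionalSubset V ∣ Y ∣ Y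
    ⊆X-proportional {Y} Y⊆X Y-dense = ⊆-trans Y⊆X X⊆V , refl ,
      ≤-trans (*-mono-≤ Y-dense (m⊓n≤m N (e V))) (≤-reflexive (*-comm (e Y + 1) N))

    X∪⊆R-proportional : ∀ {W} → ∣ X ∣ * c ≤ e X * N → W ⊆ R → 0 < ∣ W ∣ →
                        ∣ W ∣ * (∣ R ∣ ⊓ e R) ≤ ∣ R ∣ * (e W + 1) →
                        ProportionalSubset V (∣ X ∣ + ∣ W ∣) (X ∪ W)
    X∪⊆R-proportional {W} X-denser W⊆R 0<∣W∣ W-bound =
      ∪-⊆ X⊆V (⊆-trans W⊆R R⊆V) , Disjoint⇒∣p∪q∣≡∣p∣+∣q∣ X W X∩W=∅ , (begin
        (∣ X ∣ + ∣ W ∣) * c   ≤⟨ dense-part-extension-bound N≡∣X∣+∣R∣ 0<∣W∣ (p⊆q⇒∣p∣≤∣q∣ W⊆R) W-bound X-denser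
                                   (⊓-split-bound N≡∣X∣+∣R∣ (DenseAtEverySize⇒Dense X-dense) e-split X-denser) ⟩
        N * (e X + e W + 1)   ≤⟨ *-monoʳ-≤ N (+-monoˡ-≤ 1 (e-superadditive X∩W=∅)) ⟩
        N * (e (X ∪ W) + 1)   ∎)
      where
      open ≤-Reasoning
      X∩W=∅ = ⊆X-⊆R-disjoint ⊆-refl W⊆R

    ⊆R-proportional : ∀ {W} → e X * N < ∣ X ∣ * c → W ⊆ R → 0 < ∣ R ∣ →
                      ∣ W ∣ * (∣ R ∣ ⊓ e R) ≤ ∣ R ∣ * (e W + 1) → ProportionalSubset V ∣ W ∣ W
    ⊆R-proportional {W} X-sparser W⊆R 0<∣R∣ W-bound = ⊆-trans W⊆R R⊆V , refl ,
      density-transfer {∣ W ∣} {c} {∣ R ∣ ⊓ e R} {N} {∣ R ∣} 0<∣R∣ W-bound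
        (sparse-part⇒dense-complement {r = ∣ R ∣} {mR = e R} N≡∣X∣+∣R∣ e-split X-sparser)

    R∪⊆X-proportional : ∀ {Y} → e X * N < ∣ X ∣ * c → Y ⊆ X → Dense Y →
                        ProportionalSubset V (∣ R ∣ + ∣ Y ∣) (R ∪ Y)
    R∪⊆X-proportional {Y} X-sparser Y⊆X Y-dense =
      ∪-⊆ R⊆V (⊆-trans Y⊆X X⊆V) , Disjoint⇒∣p∪q∣≡∣p∣+∣q∣ R Y R∩Y=∅ , (begin
        (∣ R ∣ + ∣ Y ∣) * c   ≤⟨ dense-complement-extension-bound {r = ∣ R ∣} (m⊓n≤m N (e V)) cR≤ Y-dense ⟩
        N * (e R + e Y + 1)   ≤⟨ *-monoʳ-≤ N (+-monoˡ-≤ 1 (e-superadditive R∩Y=∅)) ⟩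
        N * (e (R ∪ Y) + 1)   ∎)
      where
      open ≤-Reasoning
      R∩Y=∅ : Disjoint R Y
      R∩Y=∅ x∈R x∈Y = ⊆X-⊆R-disjoint Y⊆X ⊆-refl x∈Y x∈R
      cR≤ = ≤-trans (sparse-part⇒dense-complement {r = ∣ R ∣} {mR = e R} N≡∣X∣+∣R∣ e-split X-sparser)
                    (*-monoˡ-≤ N (m⊓n≤n ∣ R ∣ (e R)))

    split⇒HasProportionalSubsets : ∀ {w} → 0 < w → w ≤ N → ∃ (ProportionalSubset V w)
    split⇒HasProportionalSubsets {w} 0<w w≤N with ∣ X ∣ * c ≤? e X * N | w ≤? ∣ X ∣ | w ≤? ∣ R ∣
    ... | yes X-denser | yes w≤∣X∣ | _ with X-dense w≤∣X∣
    ...   | Y , Y⊆X , refl , Y-dense = Y , ⊆X-proportional Y⊆X Y-dense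
    split⇒HasProportionalSubsets {w} 0<w w≤N | yes X-denser | no w≰∣X∣ | _
      with R-proportional (m≤n+o⇒m∸n≤o w ∣ X ∣ (subst (w ≤_) N≡∣X∣+∣R∣ w≤N))
    ...   | W , W⊆R , ∣W∣≡w∸∣X∣ , W-bound =
      X ∪ W , subst (λ t → ProportionalSubset V t (X ∪ W)) ∣X∣+∣W∣≡w
                (X∪⊆R-proportional X-denser W⊆R (subst (0 <_) (sym ∣W∣≡w∸∣X∣) (m<n⇒0<n∸m ∣X∣<w))
                  (subst (λ t → t * (∣ R ∣ ⊓ e R) ≤ ∣ R ∣ * (e W + 1)) (sym ∣W∣≡w∸∣X∣) W-bound))
      where
      ∣X∣<w = ≰⇒> w≰∣X∣
      ∣X∣+∣W∣≡w = trans (cong (∣ X ∣ +_) ∣W∣≡w∸∣X∣) (m+[n∸m]≡n (<⇒≤ ∣X∣<w))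
    split⇒HasProportionalSubsets {w} 0<w w≤N | no X-sparser | _ | yes w≤∣R∣ with R-proportional w≤∣R∣
    ...   | W , W⊆R , refl , W-bound = W , ⊆R-proportional (≰⇒> X-sparser) W⊆R (≤-trans 0<w w≤∣R∣) W-bound
    split⇒HasProportionalSubsets {w} 0<w w≤N | no X-sparser | _ | no w≰∣R∣
      with X-dense (m≤n+o⇒m∸n≤o w ∣ R ∣ (subst (w ≤_) (trans N≡∣X∣+∣R∣ (+-comm ∣ X ∣ ∣ R ∣)) w≤N))
    ...   | Y , Y⊆X , ∣Y∣≡w∸∣R∣ , Y-dense =
      R ∪ Y , subst (λ t → ProportionalSubset V t (R ∪ Y))
                (trans (cong (∣ R ∣ +_) ∣Y∣≡w∸∣R∣) (m+[n∸m]≡n (<⇒≤ (≰⇒> w≰∣R∣))))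
                (R∪⊆X-proportional (≰⇒> X-sparser) Y⊆X Y-dense)

  module _ (deg≤2 : ∀ u → degA G u ≤ 2) where

    e<e-∪-crossing : x ∈ nbhd u → x ∈ X → y ∈ nbhd u → y ∉ X → e X < e (X ∪ ⁅ y ⁆)
    e<e-∪-crossing {x} {u} {X} {y} x∈N x∈X y∈N y∉X =
      p⊂q⇒∣p∣<∣q∣ (spanned-mono (p⊆p∪q ⁅ y ⁆) , u , u∈spanned-X∪y , u∉spanned-X)
      where
      u∈spanned-X∪y = ∈spanned⁺ (x , x∈N) (∣p∣≤2⇒⊆∪⁅y⁆ (deg≤2 u) x∈N x∈X y∈N y∉X)
      u∉spanned-X : u ∉ spanned X
      u∉spanned-X u∈ = y∉X (proj₂ (∈spanned⁻ u∈) y∈N)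

    spanned-split : Saturated V X → spanned V ⊆ spanned X ∪ spanned (V ─ X)
    spanned-split {V} {X} saturated {u} u∈ with ∈spanned⁻ u∈ | nbhd u ⊆? X | nbhd u ⊆? V ─ X
    ... | ne , _ | yes N⊆X | _        = x∈p∪q⁺ (inj₁ (∈spanned⁺ ne N⊆X))
    ... | ne , _ | no _    | yes N⊆R  = x∈p∪q⁺ (inj₂ (∈spanned⁺ ne N⊆R))
    ... | _ , N⊆V | no N⊈X | no N⊈R with ⊈⇒∃∉ N⊈X | ⊈⇒∃∉ N⊈R
    ...   | y , y∈N , y∉X | x , x∈N , x∉R =
      contradiction (saturated (N⊆V y∈N) y∉X) (<⇒≱ (e<e-∪-crossing x∈N x∈X y∈N y∉X))
      where
      x∈X = decidable-stable (x ∈? X) λ x∉X → x∉R (x∈p∧x∉q⇒x∈p─q (N⊆V x∈N) x∉X)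

    Saturated⇒e≤e+e─ : Saturated V X → e V ≤ e X + e (V ─ X)
    Saturated⇒e≤e+e─ {V} {X} saturated =
      ≤-trans (p⊆q⇒∣p∣≤∣q∣ (spanned-split saturated)) (∣p∪q∣≤∣p∣+∣q∣ (spanned X) (spanned (V ─ X)))

    proportionalSubsets : ∀ V → HasProportionalSubsets V
    proportionalSubsets V = go (⊂-wellFounded V)
      where
      go : ∀ {V} → Acc _⊂_ V → HasProportionalSubsets V
      go _ {zero} _ = ⊥ , ⊥⊆ , ∣⊥∣≡0 n , z≤n
      go {V} (acc rec) {suc w} w<∣V∣ with 1≤∣p∣⇒Nonempty (≤-trans (s≤s z≤n) w<∣V∣)
      ... | v , v∈V with grow-from v∈V
      ...   | X , v∈X , X⊆V , X-dense , X-saturated =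
        split⇒HasProportionalSubsets X⊆V X-dense (Saturated⇒e≤e+e─ X-saturated)
          (go (rec (p∩q≢∅⇒p─q⊂p V X (v , x∈p∩q⁺ (v∈V , v∈X))))) (s≤s z≤n) w<∣V∣

order-bound : ∀ z M k w e → 4 * k + 4 ≤ 3 * z + 2 * M → w + k ≡ z + M →
              w * M ≤ (z + M) * (e + 1) → k ≤ z + e
order-bound z M k w e 4k+4≤ w+k≡N wM≤ = s≤s⁻¹ (subst (k <_) (solve₁ e z) (*-cancelˡ-< N k (e + 1 + z)
  (+-cancelʳ-< (k * M) (N * k) (N * (e + 1 + z)) (begin-strict
    N * k + k * M              <⟨ quadratic-gap ⟩
    N * N                      ≡⟨ partition ⟨
    w * M + N * z + k * M      ≤⟨ +-monoˡ-≤ (k * M) (+-monoˡ-≤ (N * z) wM≤) ⟩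
    N * (e + 1) + N * z + k * M ≡⟨ cong (_+ k * M) (*-distribˡ-+ N (e + 1) z) ⟨
    N * (e + 1 + z) + k * M    ∎))))
  where
  open ≤-Reasoning
  N = z + M
  solve₁ : ∀ e z → e + 1 + z ≡ suc (z + e)
  solve₁ = solve-∀
  partition : w * M + N * z + k * M ≡ N * N
  partition = begin-equality
    w * M + N * z + k * M  ≡⟨ solve₂ w N z k M ⟩
    (w + k) * M + N * z    ≡⟨ cong (λ t → t * M + N * z) w+k≡N ⟩
    N * M + N * z          ≡⟨ *-distribˡ-+ N M z ⟨
    N * (M + z)            ≡⟨ cong (N *_) (+-comm M z) ⟩
    N * N                  ∎
    where
    solve₂ : ∀ w N z k M → w * M + N * z + k * M ≡ (w + k) * M + N * z
    solve₂ = solve-∀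
  quadratic-gap : N * k + k * M < N * N
  quadratic-gap = *-cancelˡ-< 4 _ _ (begin-strict
    4 * (N * k + k * M)                   ≡⟨ solve₃ z M k ⟩
    (4 * k) * (z + 2 * M)                 <⟨ m<m+n _ (positive z M 4k+4≤) ⟩
    (4 * k) * (z + 2 * M) + 4 * (z + 2 * M) ≡⟨ *-distribʳ-+ (z + 2 * M) (4 * k) 4 ⟨
    (4 * k + 4) * (z + 2 * M)             ≤⟨ *-monoˡ-≤ (z + 2 * M) 4k+4≤ ⟩
    (3 * z + 2 * M) * (z + 2 * M)         ≤⟨ m≤m+n _ (z * z) ⟩
    (3 * z + 2 * M) * (z + 2 * M) + z * z ≡⟨ solve₄ z M ⟩
    4 * (N * N)                           ∎)
    where
    solve₃ : ∀ z M k → 4 * ((z + M) * k + k * M) ≡ (4 * k) * (z + 2 * M)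
    solve₃ = solve-∀
    solve₄ : ∀ z M → (3 * z + 2 * M) * (z + 2 * M) + z * z ≡ 4 * ((z + M) * (z + M))
    solve₄ = solve-∀
    positive : ∀ z M → 4 * k + 4 ≤ 3 * z + 2 * M → 0 < 4 * (z + 2 * M)
    positive (suc _) _       _      = s≤s z≤n
    positive zero    (suc _) _      = s≤s z≤n
    positive zero    zero    4k+4≤0 = contradiction (≤-trans (m≤n+m 4 (4 * k)) 4k+4≤0) λ ()

choose-order : ℕ → ℕ
choose-order P = (P ∸ 4) / 4

≤-choose-order : ∀ P → P ≤ 4 * choose-order P + 7
≤-choose-order P = begin
  P                                     ≤⟨ m≤n+m∸n P 4 ⟩
  4 + (P ∸ 4)                           ≡⟨ cong (4 +_) (m≡m%n+[m/n]*n (P ∸ 4) 4) ⟩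
  4 + ((P ∸ 4) % 4 + q * 4)             ≤⟨ +-monoʳ-≤ 4 (+-monoˡ-≤ (q * 4) (s≤s⁻¹ (m%n<n (P ∸ 4) 4))) ⟩
  4 + (3 + q * 4)                       ≡⟨ solve₁ q ⟩
  4 * q + 7                             ∎
  where
  open ≤-Reasoning
  q = choose-order P
  solve₁ : ∀ q → 4 + (3 + q * 4) ≡ 4 * q + 7
  solve₁ = solve-∀

choose-order-≤ : ∀ P → 1 ≤ choose-order P → 4 * choose-order P + 4 ≤ P
choose-order-≤ P 1≤q with 4 ≤? P
... | yes 4≤P = begin
  4 * q + 4      ≡⟨ cong (_+ 4) (*-comm 4 q) ⟩
  q * 4 + 4      ≤⟨ +-monoˡ-≤ 4 (m/n*n≤m (P ∸ 4) 4) ⟩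
  (P ∸ 4) + 4    ≡⟨ m∸n+n≡m 4≤P ⟩
  P              ∎
  where
  open ≤-Reasoning
  q = choose-order P
... | no 4≰P rewrite m≤n⇒m∸n≡0 (<⇒≤ (≰⇒> 4≰P)) = contradiction 1≤q λ ()

4k+4≤3z+2M⇒k≤z+M : ∀ {k z M} → 4 * k + 4 ≤ 3 * z + 2 * M → k ≤ z + M
4k+4≤3z+2M⇒k≤z+M {k} {z} {M} 4k+4≤ = *-cancelˡ-≤ 4 (begin
  4 * k                          ≤⟨ m≤m+n (4 * k) 4 ⟩
  4 * k + 4                      ≤⟨ 4k+4≤ ⟩
  3 * z + 2 * M                  ≤⟨ m≤m+n (3 * z + 2 * M) (z + 2 * M) ⟩
  3 * z + 2 * M + (z + 2 * M)    ≡⟨ solve₁ z M ⟩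
  4 * (z + M)                    ∎)
  where
  open ≤-Reasoning
  solve₁ : ∀ z M → 3 * z + 2 * M + (z + 2 * M) ≡ 4 * (z + M)
  solve₁ = solve-∀

module _ {n} (G : BipGraph n) where

  degree-class : ℕ → Subset n
  degree-class d = ⟦ (λ u → degA G u ≟ d) ⟧

  enclosed : Subset n → Subset n
  enclosed W = ⟦ (λ u → nbhd G u ⊆? W) ⟧

  private variable
    u : Fin n
    d d′ : ℕ

  ∈degree-class⁺ : degA G u ≡ d → u ∈ degree-class d
  ∈degree-class⁺ {d = d} = ∈⟦⟧⁺ {P? = λ u → degA G u ≟ d}

  ∈degree-class⁻ : u ∈ degree-class d → degA G u ≡ d
  ∈degree-class⁻ {d = d} = ∈⟦⟧⁻ {P? = λ u → degA G u ≟ d}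

  ∈enclosed⁺ : ∀ {W} → nbhd G u ⊆ W → u ∈ enclosed W
  ∈enclosed⁺ {W = W} = ∈⟦⟧⁺ {P? = λ u → nbhd G u ⊆? W}

  ∈enclosed⁻ : ∀ {W} → u ∈ enclosed W → nbhd G u ⊆ W
  ∈enclosed⁻ {W = W} = ∈⟦⟧⁻ {P? = λ u → nbhd G u ⊆? W}

  degree-class-disjoint : d ≢ d′ → Disjoint (degree-class d) (degree-class d′)
  degree-class-disjoint d≢d′ u∈d u∈d′ = d≢d′ (trans (sym (∈degree-class⁻ u∈d)) (∈degree-class⁻ u∈d′))

  degrees≤2 : ∣ degree-class 0 ∣ + ∣ degree-class 1 ∣ + ∣ degree-class 2 ∣ ≡ n → ∀ u → degA G u ≤ 2
  degrees≤2 counts u with x∈p∪q⁻ C₀ (C₁ ∪ C₂) (subst (u ∈_) (sym C₀₁₂≡⊤) ∈⊤)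
    where
    C₀ = degree-class 0
    C₁ = degree-class 1
    C₂ = degree-class 2
    C₀₁₂≡⊤ : C₀ ∪ C₁ ∪ C₂ ≡ ⊤
    C₀₁₂≡⊤ = ∣p∣≡n⇒p≡⊤ (begin
      ∣ C₀ ∪ C₁ ∪ C₂ ∣         ≡⟨ Disjoint⇒∣p∪q∣≡∣p∣+∣q∣ C₀ (C₁ ∪ C₂)
                                    (Disjoint-∪ (degree-class-disjoint λ ()) (degree-class-disjoint λ ())) ⟩
      ∣ C₀ ∣ + ∣ C₁ ∪ C₂ ∣     ≡⟨ cong (∣ C₀ ∣ +_) (Disjoint⇒∣p∪q∣≡∣p∣+∣q∣ C₁ C₂ (degree-class-disjoint λ ())) ⟩
      ∣ C₀ ∣ + (∣ C₁ ∣ + ∣ C₂ ∣) ≡⟨ +-assoc (∣ C₀ ∣) (∣ C₁ ∣) (∣ C₂ ∣) ⟨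
      ∣ C₀ ∣ + ∣ C₁ ∣ + ∣ C₂ ∣   ≡⟨ counts ⟩
      n                        ∎)
      where open ≡-Reasoning
  ... | inj₁ u∈C₀ = ≤-trans (≤-reflexive (∈degree-class⁻ u∈C₀)) z≤n
  ... | inj₂ u∈C₁₂ with x∈p∪q⁻ (degree-class 1) (degree-class 2) u∈C₁₂
  ...   | inj₁ u∈C₁ = ≤-trans (≤-reflexive (∈degree-class⁻ u∈C₁)) (s≤s z≤n)
  ...   | inj₂ u∈C₂ = ≤-reflexive (∈degree-class⁻ u∈C₂)

  ∣nbhd∣≡0⇒∉ : ∀ {x} → degA G u ≡ 0 → x ∉ nbhd G u
  ∣nbhd∣≡0⇒∉ deg≡0 x∈N = contradiction (subst (1 ≤_) deg≡0 (x∈p⇒1≤∣p∣ x∈N)) λ ()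

  isolated-spanned-disjoint : ∀ {W} → Disjoint (degree-class 0) (spanned G W)
  isolated-spanned-disjoint u∈C₀ u∈spanned with ∈spanned⁻ G u∈spanned
  ... | (x , x∈N) , _ = ∣nbhd∣≡0⇒∉ (∈degree-class⁻ u∈C₀) x∈N

  isolated+e≤∣enclosed∣ : ∀ W → ∣ degree-class 0 ∣ + e G W ≤ ∣ enclosed W ∣
  isolated+e≤∣enclosed∣ W = begin
    ∣ degree-class 0 ∣ + e G W         ≡⟨ Disjoint⇒∣p∪q∣≡∣p∣+∣q∣ _ _ isolated-spanned-disjoint ⟨
    ∣ degree-class 0 ∪ spanned G W ∣   ≤⟨ p⊆q⇒∣p∣≤∣q∣ (∪-⊆ isolated⊆ spanned⊆) ⟩
    ∣ enclosed W ∣                     ∎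
    where
    open ≤-Reasoning
    isolated⊆ : degree-class 0 ⊆ enclosed W
    isolated⊆ u∈C₀ = ∈enclosed⁺ (λ x∈N → contradiction x∈N (∣nbhd∣≡0⇒∉ (∈degree-class⁻ u∈C₀)))
    spanned⊆ : spanned G W ⊆ enclosed W
    spanned⊆ u∈ = ∈enclosed⁺ (proj₂ (∈spanned⁻ G u∈))

  n≤isolated+e⊤ : n ≤ ∣ degree-class 0 ∣ + e G ⊤
  n≤isolated+e⊤ = begin
    n                                ≡⟨ ∣⊤∣≡n n ⟨
    ∣ ⊤ {n} ∣                        ≤⟨ p⊆q⇒∣p∣≤∣q∣ ⊤⊆ ⟩
    ∣ degree-class 0 ∪ spanned G ⊤ ∣ ≡⟨ Disjoint⇒∣p∪q∣≡∣p∣+∣q∣ _ _ isolated-spanned-disjoint ⟩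
    ∣ degree-class 0 ∣ + e G ⊤       ∎
    where
    open ≤-Reasoning
    ⊤⊆ : ⊤ ⊆ degree-class 0 ∪ spanned G ⊤
    ⊤⊆ {u} _ with nonempty? (nbhd G u)
    ... | yes ne  = x∈p∪q⁺ (inj₂ (∈spanned⁺ G ne (⊆⊤ {p = nbhd G u})))
    ... | no ¬ne = x∈p∪q⁺ (inj₁ (∈degree-class⁺ (trans (cong ∣_∣ (Empty-unique ¬ne)) (∣⊥∣≡0 n))))

  enclosed⇒HasBihole : ∀ {k} W → k ≤ ∣ enclosed W ∣ → ∣ ∁ W ∣ ≡ k → HasBihole G k
  enclosed⇒HasBihole W k≤ ∣∁W∣≡k with ∃⊆-ofSize (enclosed W) k≤
  ... | S , S⊆enclosed , ∣S∣≡k = S , ∁ W , ∣S∣≡k , ∣∁W∣≡k , λ u v u∈S v∈∁W →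
    ¬-not λ Guv → x∈∁p⇒x∉p v∈∁W (∈enclosed⁻ (S⊆enclosed u∈S) (∈nbhd⁺ G Guv))

  module _ (deg≤2 : ∀ u → degA G u ≤ 2) where

    HasBihole-of-order : ∀ {z M k} → ∣ degree-class 0 ∣ ≡ z → n ≡ z + M →
                         4 * k + 4 ≤ 3 * z + 2 * M → HasBihole G k
    HasBihole-of-order {z} {M} {k} refl n≡z+M 4k+4≤
      with proportionalSubsets G deg≤2 (⊤ {n}) (subst (n ∸ k ≤_) (sym (∣⊤∣≡n n)) (m∸n≤m n k))
    ... | W , _ , ∣W∣≡n∸k , W-bound =
      enclosed⇒HasBihole W (≤-trans k≤z+eW (isolated+e≤∣enclosed∣ W)) ∣∁W∣≡k
      where
      open ≤-Reasoning
      k≤n : k ≤ n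
      k≤n = subst (k ≤_) (sym n≡z+M) (4k+4≤3z+2M⇒k≤z+M {k} {z} {M} 4k+4≤)
      M≤n⊓e⊤ : M ≤ ∣ ⊤ {n} ∣ ⊓ e G ⊤
      M≤n⊓e⊤ = ⊓-glb (subst (M ≤_) (trans (sym n≡z+M) (sym (∣⊤∣≡n n))) (m≤n+m M z))
                      (+-cancelˡ-≤ z M (e G ⊤) (subst (_≤ z + e G ⊤) n≡z+M n≤isolated+e⊤))
      k≤z+eW : k ≤ z + e G W
      k≤z+eW = order-bound z M k (n ∸ k) (e G W) 4k+4≤ (trans (m∸n+n≡m k≤n) n≡z+M) (begin
        (n ∸ k) * M                    ≤⟨ *-monoʳ-≤ (n ∸ k) M≤n⊓e⊤ ⟩
        (n ∸ k) * (∣ ⊤ {n} ∣ ⊓ e G ⊤)  ≤⟨ W-bound ⟩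
        ∣ ⊤ {n} ∣ * (e G W + 1)        ≡⟨ cong (_* (e G W + 1)) (trans (∣⊤∣≡n n) n≡z+M) ⟩
        (z + M) * (e G W + 1)          ∎)
      ∣∁W∣≡k : ∣ ∁ W ∣ ≡ k
      ∣∁W∣≡k = trans (∣∁p∣≡n∸∣p∣ W) (trans (cong (n ∸_) ∣W∣≡n∸k) (m∸[m∸n]≡n k≤n))

HasBihole-0 : ∀ {n} (G : BipGraph n) → HasBihole G 0
HasBihole-0 {n} G = ⊥ , ⊥ , ∣⊥∣≡0 n , ∣⊥∣≡0 n , λ _ _ u∈⊥ _ → contradiction u∈⊥ ∉⊥

admissible : ∀ n0 n1 n2 k → (0 < k → 4 * k + 4 ≤ 3 * n0 + 2 * (n1 + n2)) → Admissible012 n0 n1 n2 k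
admissible n0 n1 n2 zero    _     G _                   = HasBihole-0 G
admissible n0 n1 n2 (suc k) bound G (n0≡ , n1≡ , n2≡) =
  HasBihole-of-order G (degrees≤2 G (cong₂ _+_ (cong₂ _+_ n0≡ n1≡) n2≡)) n0≡ (+-assoc n0 n1 n2)
    (bound (s≤s z≤n))

theorem3 : (n0 n1 n2 : ℕ) →
    Σ ℕ λ k → (3 * n0 + 2 * (n1 + n2) ≤ 4 * k + 7) × Admissible012 n0 n1 n2 k
theorem3 n0 n1 n2 = choose-order P , ≤-choose-order P , admissible n0 n1 n2 (choose-order P) (choose-order-≤ P)
  where P = 3 * n0 + 2 * (n1 + n2)
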